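{- Let $G$ be a graph of order $n\ge 2$. Then $\operatorname{adim}_2(G)=n$ if and only if every vertex of $G$ belongs to a non-singleton twin equivalence class.
   Context: All graphs are finite and simple. For a graph $G=(V,E)$, $d_{G,2}(x,y)=\min\{d_G(x,y),2\}$ where $d_G$ is the shortest-path distance ($\infty$ between different components). For distinct $x,y$, $\mathcal{C}_G(x,y)=\{z\in V: d_{G,2}(x,z)\ne d_{G,2}(y,z)\}$. A set $S\subseteq V$ is a $2$-adjacency generator if $|S\cap \mathcal{C}_G(x,y)|\ge 2$ for all distinct $x,y$; $\operatorname{adim}_2(G)$ is the minimum cardinality of such a set. Two distinct vertices $x,y$ are twins if $N(x)\setminus\{y\}=N(y)\setminus\{x\}$; the twin relation (together with equality) is an equivalence relation whose classes are the twin equivalence classes. -}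

module Defs where

open import Data.Nat using (ℕ; _≤_; _≡ᵇ_)
open import Data.Bool using (Bool; true; false; not; if_then_else_)
open import Data.Fin using (Fin)
open import Data.Fin.Properties using (_≟_)
open import Data.Fin.Subset using (Subset; _∩_; ∣_∣)
open import Data.Vec using (tabulate)
open import Data.Product using (Σ; ∃; _×_)
open import Relation.Nullary using (¬_; does)
open import Relation.Binary.PropositionalEquality using (_≡_; _≢_)

record Graph (n : ℕ) : Set where
  field
    adj   : Fin n → Fin n → Bool
    sym   : ∀ x y → adj x y ≡ adj y x
    irrefl : ∀ x → adj x x ≡ false
open Graph public

-- d_{G,2}(x,z) = min{d_G(x,z), 2}: 0 if x = z, 1 if adjacent, 2 otherwise
-- (distance ≥ 2, including ∞ between components, is truncated to 2).
d₂ : ∀ {n} → Graph n → Fin n → Fin n → ℕ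
d₂ G x z = if does (x ≟ z) then 0 else (if adj G x z then 1 else 2)

𝒞 : ∀ {n} → Graph n → Fin n → Fin n → Subset n
𝒞 G x y = tabulate (λ z → not (d₂ G x z ≡ᵇ d₂ G y z))

Is2AdjGen : ∀ {n} → Graph n → Subset n → Set
Is2AdjGen G S = ∀ x y → x ≢ y → 2 ≤ ∣ S ∩ 𝒞 G x y ∣

Adim₂≡ : ∀ {n} → Graph n → ℕ → Set
Adim₂≡ G k =
  (Σ (Subset _) λ S → Is2AdjGen G S × ∣ S ∣ ≡ k)
  × (∀ S → Is2AdjGen G S → k ≤ ∣ S ∣)

Twins : ∀ {n} → Graph n → Fin n → Fin n → Set
Twins G x y = x ≢ y × (∀ z → z ≢ x → z ≢ y → adj G x z ≡ adj G y z)

InNonSingletonTwinClass : ∀ {n} → Graph n → Fin n → Set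
InNonSingletonTwinClass G x = ∃ λ y → Twins G x y

-- The pair {x, y} is resolved by x and y themselves (distance 0 versus a positive
-- distance), and a third vertex resolves it exactly when it is adjacent to one of
-- x, y but not the other.  So for twins x, y only x and y resolve the pair, and
-- every 2-adjacency generator must contain both; if every vertex has a twin, the
-- only generator is the whole vertex set.  Conversely, if x has no twin, then
-- every pair containing x is resolved by its other vertex and by some third
-- vertex, so the complement of {x} is already a generator.
module Submission where

open import Defs hiding (sym)
open import Data.Bool using (Bool; true; false; not; if_then_else_)
import Data.Bool.Properties as Bool
open import Data.Empty using (⊥-elim)
open import Data.Fin using (Fin)
open import Data.Fin.Properties using (_≟_; ¬∀⟶∃¬; any?; all?)
open import Data.Fin.Subset using (Subset; _∩_; ∣_∣; _∈_; _⊆_; _⊂_; ⊤; ⁅_⁆; ∁)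
open import Data.Fin.Subset.Properties
  using (_∈?_; ∈⊤; ∣⊤∣≡n; ∣⁅x⁆∣≡1; x∈⁅x⁆; x∈⁅y⁆⇒x≡y; x≢y⇒x∉⁅y⁆; x∉p⇒x∈∁p; x∈p⇒x∉∁p;
         x∈p∩q⁺; x∈p∩q⁻; x∈p∧x∉q⇒x∈p─q; x∈p⇒∣p-x∣<∣p∣; p⊆q⇒∣p∣≤∣q∣; p⊂q⇒∣p∣<∣q∣)
open import Data.Nat using (ℕ; _≤_; _<_; s≤s)
import Data.Nat.Properties as ℕ
open import Data.Product using (∃; _×_; _,_; proj₁; proj₂)
open import Data.Sum using (_⊎_; inj₁; inj₂)
open import Data.Vec.Properties using (lookup∘tabulate; []=⇒lookup; lookup⇒[]=)
open import Function using (_∘_)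
open import Function.Bundles using (_⇔_; mk⇔; Equivalence)
open import Function.Construct.Composition using (_⇔-∘_)
open import Function.Related.TypeIsomorphisms using (¬-cong-⇔)
open import Relation.Nullary using (¬_; Dec; yes; no; contradiction)
open import Relation.Nullary.Decidable using (¬?; _×-dec_; _→-dec_; dec-true; dec-false)
open import Relation.Binary.PropositionalEquality using (_≡_; _≢_; refl; sym; trans; cong; subst)

open Equivalence using (to; from)

private
  variable
    n : ℕ
    x y z : Fin n
    p : Subset n

x∈p⇒1≤∣p∣ : x ∈ p → 1 ≤ ∣ p ∣
x∈p⇒1≤∣p∣ {x = x} {p = p} x∈p = subst (_≤ ∣ p ∣) (∣⁅x⁆∣≡1 x) (p⊆q⇒∣p∣≤∣q∣ ⁅x⁆⊆p)
  where
  ⁅x⁆⊆p : ⁅ x ⁆ ⊆ p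
  ⁅x⁆⊆p y∈⁅x⁆ = subst (_∈ p) (sym (x∈⁅y⁆⇒x≡y x y∈⁅x⁆)) x∈p

x∈p∧y∈p⇒2≤∣p∣ : x ∈ p → y ∈ p → x ≢ y → 2 ≤ ∣ p ∣
x∈p∧y∈p⇒2≤∣p∣ x∈p y∈p x≢y =
  ℕ.≤-trans (s≤s (x∈p⇒1≤∣p∣ (x∈p∧x∉q⇒x∈p─q y∈p (x≢y⇒x∉⁅y⁆ (x≢y ∘ sym)))))
            (x∈p⇒∣p-x∣<∣p∣ x∈p)

p⊆⁅x⁆⇒∣p∣≤1 : p ⊆ ⁅ x ⁆ → ∣ p ∣ ≤ 1
p⊆⁅x⁆⇒∣p∣≤1 {x = x} p⊆⁅x⁆ = subst (_ ≤_) (∣⁅x⁆∣≡1 x) (p⊆q⇒∣p∣≤∣q∣ p⊆⁅x⁆)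

x≢y⇒x∈∁⁅y⁆ : x ≢ y → x ∈ ∁ ⁅ y ⁆
x≢y⇒x∈∁⁅y⁆ = x∉p⇒x∈∁p ∘ x≢y⇒x∉⁅y⁆

∣∁⁅x⁆∣<n : (x : Fin n) → ∣ ∁ ⁅ x ⁆ ∣ < n
∣∁⁅x⁆∣<n {n} x = subst (∣ ∁ ⁅ x ⁆ ∣ <_) (∣⊤∣≡n n) (p⊂q⇒∣p∣<∣q∣ ∁⁅x⁆⊂⊤)
  where
  ∁⁅x⁆⊂⊤ : ∁ ⁅ x ⁆ ⊂ ⊤
  ∁⁅x⁆⊂⊤ = (λ _ → ∈⊤) , x , ∈⊤ , x∈p⇒x∉∁p (x∈⁅x⁆ x)

1or2 : Bool → ℕ
1or2 b = if b then 1 else 2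

1or2-injective : ∀ b c → 1or2 b ≡ 1or2 c → b ≡ c
1or2-injective true  true  _ = refl
1or2-injective false false _ = refl

1or2≢0 : ∀ b → 1or2 b ≢ 0
1or2≢0 true  ()
1or2≢0 false ()

module _ (G : Graph n) where

  d₂-refl : ∀ x → d₂ G x x ≡ 0
  d₂-refl x = cong (λ b → if b then 0 else 1or2 (adj G x x)) (dec-true (x ≟ x) refl)

  d₂-adj : x ≢ z → d₂ G x z ≡ 1or2 (adj G x z)
  d₂-adj {x = x} {z = z} x≢z = cong (λ b → if b then 0 else 1or2 (adj G x z)) (dec-false (x ≟ z) x≢z)

  -- `does (m ℕ.≟ n)` is definitionally `m ≡ᵇ n`, the test in the definition of 𝒞.
  ∈𝒞⇔d₂≢ : z ∈ 𝒞 G x y ⇔ d₂ G x z ≢ d₂ G y z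
  ∈𝒞⇔d₂≢ {z = z} {x = x} {y = y} = mk⇔
    (λ z∈𝒞 d≡ → Bool.not-¬ (cong not (dec-true (d₂ G x z ℕ.≟ d₂ G y z) d≡))
                            (trans (sym (lookup∘tabulate _ z)) ([]=⇒lookup z∈𝒞)))
    (λ d≢ → lookup⇒[]= z _ (trans (lookup∘tabulate _ z)
                                   (cong not (dec-false (d₂ G x z ℕ.≟ d₂ G y z) d≢))))

  x∈𝒞[x,y] : x ≢ y → x ∈ 𝒞 G x y
  x∈𝒞[x,y] {x = x} {y = y} x≢y = from (∈𝒞⇔d₂≢ {x = x} {y = y}) λ d≡ →
    1or2≢0 (adj G y x) (trans (sym (d₂-adj (x≢y ∘ sym))) (trans (sym d≡) (d₂-refl x)))

  y∈𝒞[x,y] : x ≢ y → y ∈ 𝒞 G x y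
  y∈𝒞[x,y] {x = x} {y = y} x≢y = from (∈𝒞⇔d₂≢ {x = x} {y = y}) λ d≡ →
    1or2≢0 (adj G x y) (trans (sym (d₂-adj x≢y)) (trans d≡ (d₂-refl y)))

  d₂≡⇔adj≡ : z ≢ x → z ≢ y → d₂ G x z ≡ d₂ G y z ⇔ adj G x z ≡ adj G y z
  d₂≡⇔adj≡ z≢x z≢y rewrite d₂-adj (z≢x ∘ sym) | d₂-adj (z≢y ∘ sym) =
    mk⇔ (1or2-injective _ _) (cong 1or2)

  ∈𝒞⇔adj≢ : z ≢ x → z ≢ y → z ∈ 𝒞 G x y ⇔ adj G x z ≢ adj G y z
  ∈𝒞⇔adj≢ {x = x} {y = y} z≢x z≢y = ¬-cong-⇔ (d₂≡⇔adj≡ z≢x z≢y) ⇔-∘ ∈𝒞⇔d₂≢ {x = x} {y = y}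

  twins⇒∈𝒞⇒≡⊎≡ : Twins G x y → z ∈ 𝒞 G x y → z ≡ x ⊎ z ≡ y
  twins⇒∈𝒞⇒≡⊎≡ {x = x} {y = y} {z = z} (_ , agree) z∈𝒞 with z ≟ x | z ≟ y
  ... | yes z≡x | _       = inj₁ z≡x
  ... | no _    | yes z≡y = inj₂ z≡y
  ... | no z≢x  | no z≢y  = contradiction (agree z z≢x z≢y) (to (∈𝒞⇔adj≢ z≢x z≢y) z∈𝒞)

  agreeOutside? : ∀ x y z → Dec (z ≢ x → z ≢ y → adj G x z ≡ adj G y z)
  agreeOutside? x y z = ¬? (z ≟ x) →-dec (¬? (z ≟ y) →-dec adj G x z Bool.≟ adj G y z)

  twins? : ∀ x y → Dec (Twins G x y)
  twins? x y = ¬? (x ≟ y) ×-dec all? (agreeOutside? x y)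

  ¬twins⇒∃adj≢ : x ≢ y → ¬ Twins G x y → ∃ λ z → z ≢ x × z ≢ y × adj G x z ≢ adj G y z
  ¬twins⇒∃adj≢ {x = x} {y = y} x≢y ¬twins
    with z , disagree ← ¬∀⟶∃¬ n _ (agreeOutside? x y) (λ agree → ¬twins (x≢y , agree))
    = z , (λ z≡x → disagree λ z≢x → ⊥-elim (z≢x z≡x))
        , (λ z≡y → disagree λ _ z≢y → ⊥-elim (z≢y z≡y))
        , (λ adj≡ → disagree λ _ _ → adj≡)

  ⊤-is2AdjGen : Is2AdjGen G ⊤
  ⊤-is2AdjGen x y x≢y =
    x∈p∧y∈p⇒2≤∣p∣ (x∈p∩q⁺ (∈⊤ , x∈𝒞[x,y] x≢y)) (x∈p∩q⁺ (∈⊤ , y∈𝒞[x,y] x≢y)) x≢y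

  twin∈2AdjGen : ∀ {S} → Twins G x y → Is2AdjGen G S → x ∈ S
  twin∈2AdjGen {x = x} {y = y} {S = S} twins gen with x ∈? S
  ... | yes x∈S = x∈S
  ... | no x∉S  =
    contradiction (ℕ.≤-trans (gen x y (proj₁ twins)) (p⊆⁅x⁆⇒∣p∣≤1 S∩𝒞⊆⁅y⁆)) (ℕ.<-irrefl refl)
    where
    S∩𝒞⊆⁅y⁆ : S ∩ 𝒞 G x y ⊆ ⁅ y ⁆
    S∩𝒞⊆⁅y⁆ z∈S∩𝒞 with z∈S , z∈𝒞 ← x∈p∩q⁻ S (𝒞 G x y) z∈S∩𝒞
                   with twins⇒∈𝒞⇒≡⊎≡ twins z∈𝒞
    ... | inj₁ refl = contradiction z∈S x∉S
    ... | inj₂ refl = x∈⁅x⁆ y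

  twinless⇒∁⁅x⁆-is2AdjGen : (∀ y → ¬ Twins G x y) → Is2AdjGen G (∁ ⁅ x ⁆)
  twinless⇒∁⁅x⁆-is2AdjGen {x = x} twinless a b a≢b with a ≟ x | b ≟ x
  ... | yes refl | yes refl = contradiction refl a≢b
  ... | yes refl | no b≢x
    with z , z≢a , z≢b , adj≢ ← ¬twins⇒∃adj≢ a≢b (twinless b)
    = x∈p∧y∈p⇒2≤∣p∣ (x∈p∩q⁺ (x≢y⇒x∈∁⁅y⁆ b≢x , y∈𝒞[x,y] a≢b))
                    (x∈p∩q⁺ (x≢y⇒x∈∁⁅y⁆ z≢a , from (∈𝒞⇔adj≢ z≢a z≢b) adj≢))
                    (z≢b ∘ sym)
  ... | no a≢x   | yes refl
    with z , z≢b , z≢a , adj≢ ← ¬twins⇒∃adj≢ (a≢b ∘ sym) (twinless a)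
    = x∈p∧y∈p⇒2≤∣p∣ (x∈p∩q⁺ (x≢y⇒x∈∁⁅y⁆ a≢x , x∈𝒞[x,y] a≢b))
                    (x∈p∩q⁺ (x≢y⇒x∈∁⁅y⁆ z≢b , from (∈𝒞⇔adj≢ z≢a z≢b) (adj≢ ∘ sym)))
                    (z≢a ∘ sym)
  ... | no a≢x   | no b≢x   =
    x∈p∧y∈p⇒2≤∣p∣ (x∈p∩q⁺ (x≢y⇒x∈∁⁅y⁆ a≢x , x∈𝒞[x,y] a≢b))
                  (x∈p∩q⁺ (x≢y⇒x∈∁⁅y⁆ b≢x , y∈𝒞[x,y] a≢b))
                  a≢b

  adim₂≡n⇒twinned : Adim₂≡ G n → ∀ x → InNonSingletonTwinClass G x
  adim₂≡n⇒twinned (_ , minimal) x with any? (twins? x)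
  ... | yes twin = twin
  ... | no ¬twin = contradiction
    (minimal (∁ ⁅ x ⁆) (twinless⇒∁⁅x⁆-is2AdjGen λ y twins → ¬twin (y , twins)))
    (ℕ.<⇒≱ (∣∁⁅x⁆∣<n x))

  twinned⇒adim₂≡n : (∀ x → InNonSingletonTwinClass G x) → Adim₂≡ G n
  twinned⇒adim₂≡n twinned = (⊤ , ⊤-is2AdjGen , ∣⊤∣≡n n) , λ S gen →
    subst (_≤ ∣ S ∣) (∣⊤∣≡n n)
          (p⊆q⇒∣p∣≤∣q∣ {p = ⊤} {q = S} λ {x} _ → twin∈2AdjGen (proj₂ (twinned x)) gen)

corollary14 : (n : ℕ) → 2 ≤ n → (G : Graph n) →
    Adim₂≡ G n ⇔ (∀ (x : Fin n) → InNonSingletonTwinClass G x)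
corollary14 n _ G = mk⇔ (adim₂≡n⇒twinned G) (twinned⇒adim₂≡n G)
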